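{- Let $S_{Nice}$ be a nice shape and $S_L$ a straight line (all nodes in consecutive cells of one row or column), both of order $n$. Then $S_{Nice}$ can be transformed into $S_L$, and $S_L$ into $S_{Nice}$, using $O(n)$ line moves.
   Context: Nodes occupy distinct cells of the two-dimensional square grid, cells addressed by integer coordinates $(x,y)$. A shape is a finite set of nodes; its order is its number of nodes. Two nodes $(x_1,y_1),(x_2,y_2)$ are neighbours iff $|x_1-x_2|\le1$ and $|y_1-y_2|\le1$; a shape is connected iff its neighbour graph is connected. A line is a set of one or more nodes occupying consecutive cells of one row or column. A line move (one step): a line of $k\ge1$ nodes occupying $(x_1,y),\dots,(x_1+k-1,y)$ may move right by one cell if $(x_1+k,y)$ is empty, or left by one cell if $(x_1-1,y)$ is empty; vertical lines move up/down analogously; all nodes move simultaneously. Transforming $A$ into $B$ means a finite sequence of line moves turning $A$ into a shape obtained from $B$ by rotations and translations. A connected shape $S$ is nice if there is a line $L_C\subseteq S$ (the central line) such that every node $u\in S\setminus L_C$ is connected to $L_C$ via a line of nodes of $S$ perpendicular to $L_C$ (i.e., all cells between $u$ and $L_C$ along the perpendicular through $u$ are occupied). -}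

module Defs where

open import Data.Nat using (ℕ; zero; suc; _<_; _≤_)
open import Data.Integer as ℤ using (ℤ; +_; -_) renaming (_+_ to _+ℤ_; _*_ to _*ℤ_; _≤_ to _≤ℤ_)
open import Data.Product using (Σ; ∃; ∃-syntax; _×_; _,_; proj₁; proj₂)
open import Data.Sum using (_⊎_)
open import Data.Bool using (Bool; true; false)
open import Data.Fin using (Fin)
open import Data.List using (List; length)
open import Data.List.Membership.Propositional using (_∈_; _∉_)
open import Relation.Binary.PropositionalEquality using (_≡_; _≢_)
open import Relation.Nullary using (¬_)

Cell : Set
Cell = ℤ × ℤ

-- A shape is given by the (finite) list of its occupied cells.
-- Shapes are compared as sets of cells (membership); the order of a
-- shape is the length of a duplicate-free list representing it.
Shape : Set
Shape = List Cell

_⊕_ : Cell → Cell → Cell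
(a , b) ⊕ (c , d) = (a +ℤ c , b +ℤ d)

_·_ : ℕ → Cell → Cell
i · (a , b) = ((+ i) *ℤ a , (+ i) *ℤ b)

SameCells : Shape → Shape → Set
SameCells A B = ∀ c → (c ∈ A → c ∈ B) × (c ∈ B → c ∈ A)

data Unit : Cell → Set where
  right : Unit (+ 1 , + 0)
  left  : Unit (- (+ 1) , + 0)
  up    : Unit (+ 0 , + 1)
  down  : Unit (+ 0 , - (+ 1))

data Axis : Cell → Set where
  horiz : Axis (+ 1 , + 0)
  vert  : Axis (+ 0 , + 1)

Neighbours : Cell → Cell → Set
Neighbours (x₁ , y₁) (x₂ , y₂) =
  (ℤ.∣ x₁ ℤ.- x₂ ∣ ≤ 1) × (ℤ.∣ y₁ ℤ.- y₂ ∣ ≤ 1)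

data Path (S : Shape) : Cell → Cell → Set where
  here : ∀ {u} → Path S u u
  step : ∀ {u w v} → Neighbours u w → w ∈ S → Path S w v → Path S u v

Connected : Shape → Set
Connected S = ∀ u v → u ∈ S → v ∈ S → Path S u v

IsLine : Shape → Set
IsLine S = Σ Cell λ p → Σ Cell λ d → Σ ℕ λ k →
  Axis d × (1 ≤ k) ×
  (∀ c → (c ∈ S → ∃[ i ] (i < k × c ≡ p ⊕ (i · d)))
       × (∃[ i ] (i < k × c ≡ p ⊕ (i · d)) → c ∈ S))

-- Orientation-dependent coordinates: for `true` the central line is a row
-- (along = x, across = y), for `false` a column (along = y, across = x).
along : Bool → Cell → ℤ
along true  (x , y) = x
along false (x , y) = y

across : Bool → Cell → ℤ
across true  (x , y) = y
across false (x , y) = x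

mk : Bool → ℤ → ℤ → Cell
mk true  a b = (a , b)
mk false a b = (b , a)

Between : ℤ → ℤ → ℤ → Set
Between a t b = (a ≤ℤ t × t ≤ℤ b) ⊎ (b ≤ℤ t × t ≤ℤ a)

-- Nice shape: connected, with a central line L_C ⊆ S (cells mk o (s+i) r,
-- i < k, k ≥ 1) such that every node u of S is joined to L_C by a line of
-- nodes of S perpendicular to L_C: the foot of the perpendicular through u
-- lies on L_C and all cells between u and L_C along it are occupied.
-- (For u ∈ L_C this holds trivially.)
Nice : Shape → Set
Nice S = Connected S × Σ Bool λ o → Σ ℤ λ r → Σ ℤ λ s → Σ ℕ λ k →
  (1 ≤ k) ×
  (∀ i → i < k → mk o (s +ℤ (+ i)) r ∈ S) ×
  (∀ u → u ∈ S →
     (s ≤ℤ along o u) × (along o u ℤ.< s +ℤ (+ k)) ×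
     (∀ t → Between r t (across o u) → mk o (along o u) t ∈ S))

-- One line move from A to B: a line of k ≥ 1 nodes p, p+d, …, p+(k-1)d of A
-- moves one cell in direction d (a unit vector along the line) into the
-- empty cell p+kd; the result has p vacated and p+kd occupied.
LineMove : Shape → Shape → Set
LineMove A B = Σ Cell λ p → Σ Cell λ d → Σ ℕ λ k →
  Unit d × (1 ≤ k) ×
  (∀ i → i < k → p ⊕ (i · d) ∈ A) ×
  (p ⊕ (k · d)) ∉ A ×
  (∀ c → (c ∈ B → (c ∈ A × c ≢ p) ⊎ c ≡ p ⊕ (k · d))
       × ((c ∈ A × c ≢ p) ⊎ c ≡ p ⊕ (k · d) → c ∈ B))

data Moves : ℕ → Shape → Shape → Set where
  done : ∀ {A B} → SameCells A B → Moves 0 A B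
  move : ∀ {m A A′ B} → LineMove A A′ → Moves m A′ B → Moves (suc m) A B

rot90 : Cell → Cell
rot90 (x , y) = (- y , x)

rotN : ℕ → Cell → Cell
rotN zero    c = c
rotN (suc r) c = rot90 (rotN r c)

Congruent : Shape → Shape → Set
Congruent C B = Σ ℕ λ r → Σ Cell λ t → (r < 4) ×
  (∀ c → (c ∈ C → ∃[ b ] (b ∈ B × c ≡ rotN r b ⊕ t))
       × (∃[ b ] (b ∈ B × c ≡ rotN r b ⊕ t) → c ∈ C))

Transforms : ℕ → Shape → Shape → Set
Transforms m A B = Σ Shape λ C → Congruent C B × Moves m A C

module Submission where

-- A nice shape is in particular a comb: a row (its central line) together
-- with columns of nodes hanging above and below it.  A comb is flattened
-- one node at a time.  Take a node u of maximal distance from the row; it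
-- is the top of its column.  One move shifts the part of the row from the
-- foot R j of that column to its end one cell forward, freeing R j; a second
-- move slides the column from u down into R j.  As cells, this replaces u by
-- the new end R ℓ of the row, and the result is again a comb on a longer row.
-- After n - k such double steps (k the length of the central line) the shape
-- is a line of order n, so 2n moves suffice.  Line moves are reversible and
-- commute with rotations and translations, and any two lines of the same
-- order are congruent; this yields both directions of the proposition.

open import Defs
open import Data.Bool using (Bool; true; false)
open import Data.Empty using (⊥-elim)
open import Data.Integer as ℤ using (ℤ; +_; -_)
  renaming (_+_ to _+ℤ_; _*_ to _*ℤ_; _≤_ to _≤ℤ_; _<_ to _<ℤ_)
import Data.Integer.Properties as ℤP
open import Data.Integer.Tactic.RingSolver using (solve-∀)
open import Data.List using (List; []; _∷_; length; map; filter; applyUpTo)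
open import Data.List.Properties using (length-applyUpTo; filter-notAll)
open import Data.List.Membership.Propositional using (_∈_; _∉_)
open import Data.List.Membership.Propositional.Properties
  using (∈-map⁺; ∈-map⁻; ∈-filter⁺; ∈-filter⁻; ∈-applyUpTo⁺; ∈-applyUpTo⁻)
open import Data.List.Relation.Binary.Subset.Propositional using (_⊆_)
open import Data.List.Extrema.Nat using (argmax; argmax-sel; f[⊥]≤f[argmax]; f[xs]≤f[argmax])
open import Data.List.Relation.Unary.All as All using (All)
open import Data.List.Relation.Unary.Any as Any using (here; there)
open import Data.List.Relation.Unary.AllPairs using ([]; _∷_)
open import Data.List.Relation.Unary.Unique.Propositional using (Unique)
open import Data.List.Relation.Unary.Unique.Propositional.Properties using (filter⁺; applyUpTo⁺₁)
open import Data.Nat as ℕ using (ℕ; zero; suc; _≤_; _<_; _*_; _∸_; z≤n; s≤s)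
import Data.Nat.Properties as ℕP
open import Data.Product using (Σ; ∃; ∃-syntax; _×_; _,_; proj₁; proj₂)
open import Data.Product.Properties using (≡-dec; ,-injectiveˡ; ,-injectiveʳ)
open import Data.Sum using (_⊎_; inj₁; inj₂)
import Data.Sum as Sum
open import Relation.Binary.Definitions using (DecidableEquality)
open import Relation.Binary.PropositionalEquality
open import Relation.Nullary using (yes; no; ¬?)

open import Algebra.Properties.AbelianGroup ℤP.+-0-abelianGroup using (∙-cancelˡ; ∙-cancelʳ)

_≟c_ : DecidableEquality Cell
_≟c_ = ≡-dec ℤ._≟_ ℤ._≟_

offset : ℤ → ℤ → ℕ → ℤ
offset a c k = a +ℤ + k *ℤ c

offset-injective : ∀ a c .{{_ : ℤ.NonZero c}} {i j} → offset a c i ≡ offset a c j → i ≡ j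
offset-injective a c {i} {j} e =
  ℤP.+-injective (ℤP.*-cancelʳ-≡ (+ i) (+ j) c (∙-cancelˡ a _ _ e))

offset-zero : ∀ a c → offset a c 0 ≡ a
offset-zero a c = ℤP.+-identityʳ a

offset-back : ∀ a c k i → i ≤ k → offset a c k +ℤ + i *ℤ (- c) ≡ offset a c (k ∸ i)
offset-back a c k i i≤k = begin
  (a +ℤ + k *ℤ c) +ℤ + i *ℤ (- c) ≡⟨ distrib a (+ k) (+ i) c ⟩
  a +ℤ (+ k ℤ.- + i) *ℤ c          ≡⟨ cong (λ z → a +ℤ z *ℤ c) (trans (ℤP.m-n≡m⊖n k i) (ℤP.⊖-≥ i≤k)) ⟩
  a +ℤ + (k ∸ i) *ℤ c              ∎
  where
  open ≡-Reasoning
  distrib : ∀ a k i c → (a +ℤ k *ℤ c) +ℤ i *ℤ (- c) ≡ a +ℤ (k ℤ.- i) *ℤ c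
  distrib = solve-∀

step-injective : ∀ {d} → Unit d → ∀ p {i j} → p ⊕ (i · d) ≡ p ⊕ (j · d) → i ≡ j
step-injective right (a , _) e = offset-injective a (+ 1) (,-injectiveˡ e)
step-injective left  (a , _) e = offset-injective a (- (+ 1)) (,-injectiveˡ e)
step-injective up    (_ , b) e = offset-injective b (+ 1) (,-injectiveʳ e)
step-injective down  (_ , b) e = offset-injective b (- (+ 1)) (,-injectiveʳ e)

⊕-zero· : ∀ p d → p ⊕ (0 · d) ≡ p
⊕-zero· (a , b) (c , e) = cong₂ _,_ (offset-zero a c) (offset-zero b e)

module Counting {A : Set} (_≟_ : DecidableEquality A) where

  remove : A → List A → List A
  remove u = filter (λ x → ¬? (x ≟ u))

  ∈-remove⁺ : ∀ {u c} xs → c ∈ xs → c ≢ u → c ∈ remove u xs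
  ∈-remove⁺ {u} xs = ∈-filter⁺ (λ x → ¬? (x ≟ u))

  ∈-remove⁻ : ∀ {u c} xs → c ∈ remove u xs → c ∈ xs × c ≢ u
  ∈-remove⁻ {u} xs = ∈-filter⁻ (λ x → ¬? (x ≟ u))

  remove-unique : ∀ {u xs} → Unique xs → Unique (remove u xs)
  remove-unique {u} = filter⁺ (λ x → ¬? (x ≟ u))

  length-remove< : ∀ {u} xs → u ∈ xs → length (remove u xs) < length xs
  length-remove< {u} xs u∈xs =
    filter-notAll (λ x → ¬? (x ≟ u)) xs (Any.map (λ u≡x x≢u → x≢u (sym u≡x)) u∈xs)

  length-mono-⊆ : ∀ {xs ys} → Unique xs → xs ⊆ ys → length xs ≤ length ys
  length-mono-⊆ {[]} _ _ = z≤n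
  length-mono-⊆ {x ∷ xs} {ys} (x∉xs ∷ un) xs⊆ys = ℕP.≤-trans
    (s≤s (length-mono-⊆ un xs⊆ys−x))
    (length-remove< ys (xs⊆ys (here refl)))
    where
    xs⊆ys−x : xs ⊆ remove x ys
    xs⊆ys−x m = ∈-remove⁺ ys (xs⊆ys (there m)) (λ c≡x → All.lookup x∉xs m (sym c≡x))

  length-remove : ∀ {u xs} → Unique xs → u ∈ xs → suc (length (remove u xs)) ≡ length xs
  length-remove {u} {xs} un u∈xs = ℕP.≤-antisym (length-remove< xs u∈xs) (length-mono-⊆ un split)
    where
    split : xs ⊆ u ∷ remove u xs
    split {c} m with c ≟ u
    ... | yes c≡u = here c≡u
    ... | no c≢u = there (∈-remove⁺ xs m c≢u)

  applyUpTo-unique : ∀ (f : ℕ → A) → (∀ {i j} → f i ≡ f j → i ≡ j) → ∀ n → Unique (applyUpTo f n)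
  applyUpTo-unique f inj n = applyUpTo⁺₁ f n (λ i<j _ e → ℕP.<⇒≢ i<j (inj e))

open Counting _≟c_

sameCells⇒sameLength : ∀ {A B} → Unique A → Unique B → SameCells A B → length A ≡ length B
sameCells⇒sameLength unA unB same = ℕP.≤-antisym
  (length-mono-⊆ unA (λ {c} → proj₁ (same c)))
  (length-mono-⊆ unB (λ {c} → proj₂ (same c)))

OnLine : Cell → Cell → ℕ → Cell → Set
OnLine p d n c = ∃[ i ] (i < n × c ≡ p ⊕ (i · d))

-- (Wrapped in a record so that p, d and n can be inferred from the type.)
record LineShape (S : Shape) (p d : Cell) (n : ℕ) : Set where
  constructor lineShape
  field exactly : ∀ c → (c ∈ S → OnLine p d n c) × (OnLine p d n c → c ∈ S)

sameLineShape : ∀ {A B p d n} → LineShape A p d n → LineShape B p d n → SameCells A B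
sameLineShape (lineShape lineA) (lineShape lineB) c =
  (λ m → proj₂ (lineB c) (proj₁ (lineA c) m)) , (λ m → proj₂ (lineA c) (proj₁ (lineB c) m))

lineShape-length : ∀ {S p d n} → Unit d → Unique S → LineShape S p d n → length S ≡ n
lineShape-length {S} {p} {d} {n} unit unS lineS = begin
  length S                 ≡⟨ sameCells⇒sameLength unS unL (sameLineShape lineS lineL) ⟩
  length (applyUpTo cell n) ≡⟨ length-applyUpTo cell n ⟩
  n                        ∎
  where
  open ≡-Reasoning
  cell : ℕ → Cell
  cell i = p ⊕ (i · d)
  unL : Unique (applyUpTo cell n)
  unL = applyUpTo-unique cell (step-injective unit p) n
  lineL : LineShape (applyUpTo cell n) p d n
  lineL = lineShape λ c → ∈-applyUpTo⁻ cell , λ { (i , i<n , refl) → ∈-applyUpTo⁺ cell {i} {n} i<n }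

SameCells-refl : ∀ {A} → SameCells A A
SameCells-refl c = (λ m → m) , (λ m → m)

SameCells-sym : ∀ {A B} → SameCells A B → SameCells B A
SameCells-sym same c = proj₂ (same c) , proj₁ (same c)

SameCells-trans : ∀ {A B C} → SameCells A B → SameCells B C → SameCells A C
SameCells-trans AB BC c =
  (λ m → proj₁ (BC c) (proj₁ (AB c) m)) , (λ m → proj₂ (AB c) (proj₂ (BC c) m))

lineMove-resp : ∀ {A A′ B} → SameCells A A′ → LineMove A′ B → LineMove A B
lineMove-resp same (p , d , k , unit , k≥1 , cells , free , spec) =
  p , d , k , unit , k≥1 , (λ i i<k → proj₂ (same (p ⊕ (i · d))) (cells i i<k)) ,
  (λ m → free (proj₁ (same (p ⊕ (k · d))) m)) ,
  λ c → (λ m → Sum.map₁ (λ (x , y) → proj₂ (same c) x , y) (proj₁ (spec c) m)) ,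
        (λ h → proj₂ (spec c) (Sum.map₁ (λ (x , y) → proj₁ (same c) x , y) h))

moves-resp : ∀ {m A A′ C} → SameCells A A′ → Moves m A′ C → Moves m A C
moves-resp same (done s)        = done (SameCells-trans same s)
moves-resp same (move lm moves) = move (lineMove-resp same lm) moves

_▷_ : ∀ {m X Y Z} → Moves m X Y → LineMove Y Z → Moves (suc m) X Z
done s ▷ lm       = move (lineMove-resp s lm) (done SameCells-refl)
move l moves ▷ lm = move l (moves ▷ lm)

_++ᴹ_ : ∀ {m m′ X Y Z} → Moves m X Y → Moves m′ Y Z → Moves (m ℕ.+ m′) X Z
done s ++ᴹ moves′       = moves-resp s moves′
move l moves ++ᴹ moves′ = move l (moves ++ᴹ moves′)

after : Shape → Cell → Cell → Shape
after A p q = q ∷ remove p A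

∈-after⁻ : ∀ {A p q c} → c ∈ after A p q → (c ∈ A × c ≢ p) ⊎ c ≡ q
∈-after⁻     (here c≡q) = inj₂ c≡q
∈-after⁻ {A} (there m)  = inj₁ (∈-remove⁻ A m)

∈-after⁺ : ∀ {A p q c} → (c ∈ A × c ≢ p) ⊎ c ≡ q → c ∈ after A p q
∈-after⁺     (inj₂ c≡q)      = here c≡q
∈-after⁺ {A} (inj₁ (m , c≢p)) = there (∈-remove⁺ A m c≢p)

lineMove : ∀ {A p d k q} → Unit d → 1 ≤ k → (∀ i → i < k → p ⊕ (i · d) ∈ A) →
  p ⊕ (k · d) ≡ q → q ∉ A → LineMove A (after A p q)
lineMove unit k≥1 cells refl free =
  _ , _ , _ , unit , k≥1 , cells , free , λ c → ∈-after⁻ , ∈-after⁺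

negC : Cell → Cell
negC (a , b) = (- a , - b)

negUnit : ∀ {d} → Unit d → Unit (negC d)
negUnit right = left
negUnit left  = right
negUnit up    = down
negUnit down  = up

step-back : ∀ p d k i → i ≤ k → (p ⊕ (k · d)) ⊕ (i · negC d) ≡ p ⊕ ((k ∸ i) · d)
step-back (a , b) (c , e) k i i≤k = cong₂ _,_ (offset-back a c k i i≤k) (offset-back b e k i i≤k)

-- The reverse of moving p, …, p+(k-1)d into q = p+kd: the line
-- q, …, q-(k-1)d steps back into the vacated cell p.
reverseMove : ∀ {A B} → LineMove A B → LineMove B A
reverseMove {A} {B} (p , d , k , unit , k≥1 , cells , free , spec) =
  q , negC d , k , negUnit unit , k≥1 , cells′ , free′ , spec′
  where
  q : Cell
  q = p ⊕ (k · d)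
  p≢p+id : ∀ i → 1 ≤ i → p ⊕ (i · d) ≢ p
  p≢p+id i i≥1 e = ℕP.<⇒≢ i≥1 (sym (step-injective unit p (trans e (sym (⊕-zero· p d)))))
  q-k : q ⊕ (k · negC d) ≡ p
  q-k = trans (step-back p d k k ℕP.≤-refl) (trans (cong (λ z → p ⊕ (z · d)) (ℕP.n∸n≡0 k)) (⊕-zero· p d))
  cells′ : ∀ i → i < k → q ⊕ (i · negC d) ∈ B
  cells′ i i<k rewrite step-back p d k i (ℕP.<⇒≤ i<k) with k ∸ i ℕ.≟ k
  ... | yes k-i≡k rewrite k-i≡k = proj₂ (spec q) (inj₂ refl)
  ... | no  k-i≢k = proj₂ (spec _) (inj₁ (cells (k ∸ i) (ℕP.≤∧≢⇒< (ℕP.m∸n≤m k i) k-i≢k) ,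
                                          p≢p+id (k ∸ i) (ℕP.m<n⇒0<n∸m i<k)))
  free′ : q ⊕ (k · negC d) ∉ B
  free′ m rewrite q-k with proj₁ (spec p) m
  ... | inj₁ (_ , p≢p) = p≢p refl
  ... | inj₂ p≡q       = p≢p+id k k≥1 (sym p≡q)
  spec′ : ∀ c → (c ∈ A → (c ∈ B × c ≢ q) ⊎ c ≡ q ⊕ (k · negC d))
               × ((c ∈ B × c ≢ q) ⊎ c ≡ q ⊕ (k · negC d) → c ∈ A)
  spec′ c rewrite q-k = to , from
    where
    to : c ∈ A → (c ∈ B × c ≢ q) ⊎ c ≡ p
    to m with c ≟c p
    ... | yes c≡p = inj₂ c≡p
    ... | no  c≢p = inj₁ (proj₂ (spec c) (inj₁ (m , c≢p)) , λ { refl → free m })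
    from : (c ∈ B × c ≢ q) ⊎ c ≡ p → c ∈ A
    from (inj₁ (m , c≢q)) with proj₁ (spec c) m
    ... | inj₁ (c∈A , _) = c∈A
    ... | inj₂ c≡q       = ⊥-elim (c≢q c≡q)
    from (inj₂ refl) = subst (_∈ A) (⊕-zero· p d) (cells 0 k≥1)

reverseMoves : ∀ {m A C} → Moves m A C → Moves m C A
reverseMoves (done same)     = done (SameCells-sym same)
reverseMoves (move lm moves) = reverseMoves moves ▷ reverseMove lm

rot90-⊕ : ∀ p p′ → rot90 (p ⊕ p′) ≡ rot90 p ⊕ rot90 p′
rot90-⊕ (a , b) (c , e) = cong (_, a +ℤ c) (ℤP.neg-distrib-+ b e)

rot90-· : ∀ i p → rot90 (i · p) ≡ i · rot90 p
rot90-· i (a , b) = cong (_, + i *ℤ a) (ℤP.neg-distribʳ-* (+ i) b)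

rotN-⊕ : ∀ q p p′ → rotN q (p ⊕ p′) ≡ rotN q p ⊕ rotN q p′
rotN-⊕ zero    p p′ = refl
rotN-⊕ (suc q) p p′ = trans (cong rot90 (rotN-⊕ q p p′)) (rot90-⊕ (rotN q p) (rotN q p′))

rotN-· : ∀ q i p → rotN q (i · p) ≡ i · rotN q p
rotN-· zero    i p = refl
rotN-· (suc q) i p = trans (cong rot90 (rotN-· q i p)) (rot90-· i (rotN q p))

rotN-injective : ∀ q {p p′} → rotN q p ≡ rotN q p′ → p ≡ p′
rotN-injective zero    e = e
rotN-injective (suc q) {p} {p′} e = rotN-injective q (rot90-injective e)
  where
  rot90-injective : ∀ {x y} → rot90 x ≡ rot90 y → x ≡ y
  rot90-injective {_ , _} {_ , _} e =
    cong₂ _,_ (,-injectiveʳ e) (ℤP.neg-injective (,-injectiveˡ e))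

rotN-unit : ∀ q {d} → Unit d → Unit (rotN q d)
rotN-unit zero    unit = unit
rotN-unit (suc q) unit = rot90-unit (rotN-unit q unit)
  where
  rot90-unit : ∀ {d} → Unit d → Unit (rot90 d)
  rot90-unit right = up
  rot90-unit left  = down
  rot90-unit up    = left
  rot90-unit down  = right

iso : ℕ → Cell → Cell → Cell
iso q t c = rotN q c ⊕ t

iso-injective : ∀ q t {p p′} → iso q t p ≡ iso q t p′ → p ≡ p′
iso-injective q t {p} {p′} e = rotN-injective q (translate-injective e)
  where
  translate-injective : ∀ {x y} → x ⊕ t ≡ y ⊕ t → x ≡ y
  translate-injective {_ , _} {_ , _} e =
    cong₂ _,_ (∙-cancelʳ _ _ _ (,-injectiveˡ e)) (∙-cancelʳ _ _ _ (,-injectiveʳ e))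

iso-step : ∀ q t p i d → iso q t (p ⊕ (i · d)) ≡ iso q t p ⊕ (i · rotN q d)
iso-step q t p i d = begin
  rotN q (p ⊕ (i · d)) ⊕ t           ≡⟨ cong (_⊕ t) (rotN-⊕ q p (i · d)) ⟩
  (rotN q p ⊕ rotN q (i · d)) ⊕ t    ≡⟨ cong (λ z → (rotN q p ⊕ z) ⊕ t) (rotN-· q i d) ⟩
  (rotN q p ⊕ (i · rotN q d)) ⊕ t    ≡⟨ swap (rotN q p) (i · rotN q d) t ⟩
  (rotN q p ⊕ t) ⊕ (i · rotN q d)    ∎
  where
  open ≡-Reasoning
  swap : ∀ x y z → (x ⊕ y) ⊕ z ≡ (x ⊕ z) ⊕ y
  swap (a , b) (c , e) (f , g) = cong₂ _,_ (comm a c f) (comm b e g)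
    where
    comm : ∀ a c f → (a +ℤ c) +ℤ f ≡ (a +ℤ f) +ℤ c
    comm = solve-∀

iso-lineMove : ∀ q t {A B} → LineMove A B → LineMove (map (iso q t) A) (map (iso q t) B)
iso-lineMove q t {A} {B} (p , d , k , unit , k≥1 , cells , free , spec) =
  h p , rotN q d , k , rotN-unit q unit , k≥1 ,
  (λ i i<k → subst (_∈ map h A) (iso-step q t p i d) (∈-map⁺ h (cells i i<k))) ,
  free′ , spec′
  where
  h : Cell → Cell
  h = iso q t
  free′ : h p ⊕ (k · rotN q d) ∉ map h A
  free′ m rewrite sym (iso-step q t p k d) with ∈-map⁻ h m
  ... | _ , a∈A , e rewrite iso-injective q t e = free a∈A
  spec′ : ∀ c → (c ∈ map h B → (c ∈ map h A × c ≢ h p) ⊎ c ≡ h p ⊕ (k · rotN q d))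
              × ((c ∈ map h A × c ≢ h p) ⊎ c ≡ h p ⊕ (k · rotN q d) → c ∈ map h B)
  spec′ c rewrite sym (iso-step q t p k d) = to , from
    where
    to : c ∈ map h B → (c ∈ map h A × c ≢ h p) ⊎ c ≡ h (p ⊕ (k · d))
    to m with ∈-map⁻ h m
    ... | b , b∈B , refl with proj₁ (spec b) b∈B
    ... | inj₁ (b∈A , b≢p) = inj₁ (∈-map⁺ h b∈A , λ e → b≢p (iso-injective q t e))
    ... | inj₂ refl        = inj₂ refl
    from : (c ∈ map h A × c ≢ h p) ⊎ c ≡ h (p ⊕ (k · d)) → c ∈ map h B
    from (inj₁ (m , c≢hp)) with ∈-map⁻ h m
    ... | a , a∈A , refl = ∈-map⁺ h (proj₂ (spec a) (inj₁ (a∈A , λ { refl → c≢hp refl })))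
    from (inj₂ refl) = ∈-map⁺ h (proj₂ (spec _) (inj₂ refl))

map-SameCells : ∀ f {A B} → SameCells A B → SameCells (map f A) (map f B)
map-SameCells f same c = image (λ a → proj₁ (same a)) , image (λ a → proj₂ (same a))
  where
  image : ∀ {X Y} → (∀ a → a ∈ X → a ∈ Y) → c ∈ map f X → c ∈ map f Y
  image X⊆Y m with ∈-map⁻ f m
  ... | a , a∈X , refl = ∈-map⁺ f (X⊆Y a a∈X)

iso-moves : ∀ q t {m A B} → Moves m A B → Moves m (map (iso q t) A) (map (iso q t) B)
iso-moves q t (done same)     = done (map-SameCells (iso q t) same)
iso-moves q t (move lm moves) = move (iso-lineMove q t lm) (iso-moves q t moves)

congruent-image : ∀ {C B} q t → q < 4 → SameCells C (map (iso q t) B) → Congruent C B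
congruent-image {C} {B} q t q<4 same = q , t , q<4 , λ c →
  (λ m → ∈-map⁻ (iso q t) (proj₁ (same c) m)) ,
  (λ { (b , b∈B , refl) → proj₂ (same _) (∈-map⁺ (iso q t) b∈B) })

_⊖c_ : Cell → Cell → Cell
(a , b) ⊖c (c , e) = (a ℤ.- c , b ℤ.- e)

align : ∀ q {A p d p′ d′ n} → rotN q d ≡ d′ → LineShape A p d n →
  LineShape (map (iso q (p′ ⊖c rotN q p)) A) p′ d′ n
align q {A} {p} {d} {p′} {d′} {n} refl (lineShape lineA) = lineShape λ c →
  (λ m → let (a , a∈A , c≡ha) = ∈-map⁻ h m ; (i , i<n , a≡) = proj₁ (lineA a) a∈A in
     i , i<n , trans c≡ha (trans (cong h a≡) (image i))) ,
  (λ { (i , i<n , refl) → subst (_∈ map h A) (image i) (∈-map⁺ h (proj₂ (lineA _) (i , i<n , refl))) })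
  where
  h : Cell → Cell
  h = iso q (p′ ⊖c rotN q p)
  start : ∀ x y → x ⊕ (y ⊖c x) ≡ y
  start (a , b) (c , e) = cong₂ _,_ (cancel a c) (cancel b e)
    where
    cancel : ∀ a c → a +ℤ (c ℤ.- a) ≡ c
    cancel = solve-∀
  image : ∀ i → h (p ⊕ (i · d)) ≡ p′ ⊕ (i · rotN q d)
  image i = trans (iso-step q _ p i d) (cong (_⊕ (i · rotN q d)) (start (rotN q p) p′))

neg-+-cancel : ∀ r x → - r +ℤ (r +ℤ x) ≡ x
neg-+-cancel = solve-∀

+-cancelˡ-≤ : ∀ r {x y} → r +ℤ x ≤ℤ r +ℤ y → x ≤ℤ y
+-cancelˡ-≤ r {x} {y} h = subst₂ _≤ℤ_ (neg-+-cancel r x) (neg-+-cancel r y) (ℤP.+-monoʳ-≤ (- r) h)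

+-cancelˡ-< : ∀ r {x y} → r +ℤ x <ℤ r +ℤ y → x <ℤ y
+-cancelˡ-< r {x} {y} h = subst₂ _<ℤ_ (neg-+-cancel r x) (neg-+-cancel r y) (ℤP.+-monoʳ-< (- r) h)

≤⇒∃+ : ∀ {s a} → s ≤ℤ a → ∃[ j ] (a ≡ s +ℤ + j)
≤⇒∃+ {s} {a} s≤a = ℤ.∣ a ℤ.- s ∣ ,
  trans (split s a) (cong (s +ℤ_) (sym (ℤP.0≤i⇒+∣i∣≡i (ℤP.i≤j⇒0≤j-i s≤a))))
  where
  split : ∀ s a → a ≡ s +ℤ (a ℤ.- s)
  split = solve-∀

between-self : ∀ {r t} → Between r t r → t ≡ r
between-self (inj₁ (r≤t , t≤r)) = ℤP.≤-antisym t≤r r≤t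
between-self (inj₂ (r≤t , t≤r)) = ℤP.≤-antisym t≤r r≤t

data UnitSign : ℤ → Set where
  pos : UnitSign (+ 1)
  neg : UnitSign (- (+ 1))

offset-pos : ∀ r K → offset r (+ 1) K ≡ r +ℤ + K
offset-pos r K = cong (r +ℤ_) (ℤP.*-identityʳ (+ K))

offset-neg : ∀ r K → offset r (- (+ 1)) K ≡ r +ℤ - (+ K)
offset-neg r K = cong (r +ℤ_) (trans (ℤP.*-comm (+ K) (- (+ 1))) (ℤP.-1*i≡-i (+ K)))

offset-sign-injective : ∀ {σ} r → UnitSign σ → ∀ {i j} → offset r σ i ≡ offset r σ j → i ≡ j
offset-sign-injective r pos = offset-injective r (+ 1)
offset-sign-injective r neg = offset-injective r (- (+ 1))

signed-offset : ∀ r a → ∃[ σ ] ∃[ K ] (UnitSign σ × a ≡ offset r σ K)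
signed-offset r a with ℤP.≤-total r a
... | inj₁ r≤a = let (K , a≡) = ≤⇒∃+ r≤a in + 1 , K , pos , trans a≡ (sym (offset-pos r K))
... | inj₂ a≤r = let (K , r≡) = ≤⇒∃+ a≤r in - (+ 1) , K , neg ,
  trans (shift a (+ K)) (trans (cong (_+ℤ - (+ K)) (sym r≡)) (sym (offset-neg r K)))
  where
  shift : ∀ a x → a ≡ (a +ℤ x) +ℤ - x
  shift = solve-∀

dist-offset : ∀ {σ} r K → UnitSign σ → ℤ.∣ offset r σ K ℤ.- r ∣ ≡ K
dist-offset r K pos = cong ℤ.∣_∣ (trans (cong (ℤ._- r) (offset-pos r K)) (cancel r (+ K)))
  where
  cancel : ∀ r x → (r +ℤ x) ℤ.- r ≡ x
  cancel = solve-∀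
dist-offset r K neg = trans (cong ℤ.∣_∣ (trans (cong (ℤ._- r) (offset-neg r K)) (cancel r (+ K))))
                            (ℤP.∣-i∣≡∣i∣ (+ K))
  where
  cancel : ∀ r x → (r +ℤ - x) ℤ.- r ≡ - x
  cancel = solve-∀

between-offset⁺ : ∀ {σ} r {i K} → UnitSign σ → i ≤ K → Between r (offset r σ i) (offset r σ K)
between-offset⁺ r {i} {K} pos i≤K rewrite offset-pos r i | offset-pos r K =
  inj₁ (ℤP.i≤i+j r (+ i) , ℤP.+-monoʳ-≤ r (ℤ.+≤+ i≤K))
between-offset⁺ r {i} {K} neg i≤K rewrite offset-neg r i | offset-neg r K =
  inj₂ (ℤP.+-monoʳ-≤ r (ℤP.neg-mono-≤ (ℤ.+≤+ i≤K)) ,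
        subst (r +ℤ - (+ i) ≤ℤ_) (ℤP.+-identityʳ r) (ℤP.+-monoʳ-≤ r (ℤP.neg-mono-≤ (ℤ.+≤+ z≤n))))

between-offset⁻ : ∀ {σ} r {t} K → UnitSign σ → Between r t (offset r σ K) →
  ∃[ i ] (i ≤ K × t ≡ offset r σ i)
between-offset⁻ r {t} K pos h rewrite offset-pos r K with h
... | inj₁ (r≤t , t≤r+K) = let (i , t≡) = ≤⇒∃+ r≤t in
  i , ℤP.drop‿+≤+ (+-cancelˡ-≤ r (subst (_≤ℤ r +ℤ + K) t≡ t≤r+K)) , trans t≡ (sym (offset-pos r i))
... | inj₂ (r+K≤t , t≤r) with ℕP.n≤0⇒n≡0 (ℤP.drop‿+≤+ (+-cancelˡ-≤ r
        (subst (r +ℤ + K ≤ℤ_) (sym (ℤP.+-identityʳ r)) (ℤP.≤-trans r+K≤t t≤r))))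
... | refl = 0 , z≤n , trans (ℤP.≤-antisym t≤r (subst (_≤ℤ t) (ℤP.+-identityʳ r) r+K≤t))
                             (sym (offset-zero r (+ 1)))
between-offset⁻ r {t} K neg h rewrite offset-neg r K with h
... | inj₂ (r-K≤t , t≤r) = let (i , r≡) = ≤⇒∃+ t≤r ; t≡ = back t r i r≡ in
  i , ℤP.drop‿+≤+ (ℤP.neg-cancel-≤ (+-cancelˡ-≤ r (subst (r +ℤ - (+ K) ≤ℤ_) t≡ r-K≤t))) ,
  trans t≡ (sym (offset-neg r i))
  where
  shift : ∀ t x → t ≡ (t +ℤ x) +ℤ - x
  shift = solve-∀
  back : ∀ t r i → r ≡ t +ℤ + i → t ≡ r +ℤ - (+ i)
  back t r i r≡ = trans (shift t (+ i)) (cong (_+ℤ - (+ i)) (sym r≡))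
... | inj₁ (r≤t , t≤r-K) with ℕP.n≤0⇒n≡0 (ℤP.drop‿+≤+ (ℤP.neg-cancel-≤ (+-cancelˡ-≤ r
        (subst (_≤ℤ r +ℤ - (+ K)) (sym (ℤP.+-identityʳ r)) (ℤP.≤-trans r≤t t≤r-K)))))
... | refl = 0 , z≤n , trans (ℤP.≤-antisym (subst (t ≤ℤ_) (ℤP.+-identityʳ r) t≤r-K) r≤t)
                             (sym (offset-zero r (- (+ 1))))

between-far : ∀ r {y a} → Between r y a → ℤ.∣ a ℤ.- r ∣ ≤ ℤ.∣ y ℤ.- r ∣ → a ≡ y
between-far r {y} {a} y-between a-near with signed-offset r a
... | σ , K , sign , refl with between-offset⁻ r K sign y-between
... | i , i≤K , refl rewrite dist-offset r K sign | dist-offset r i sign =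
  cong (offset r σ) (ℕP.≤-antisym a-near i≤K)

maximiser : ∀ {A : Set} (f : A → ℕ) x xs →
  ∃[ u ] (u ∈ x ∷ xs × (∀ {v} → v ∈ x ∷ xs → f v ≤ f u))
maximiser f x xs = argmax f x xs , u∈ , bound
  where
  u∈ : argmax f x xs ∈ x ∷ xs
  u∈ = Sum.[ Any.here , Any.there ]′ (argmax-sel f x xs)
  bound : ∀ {v} → v ∈ x ∷ xs → f v ≤ f (argmax f x xs)
  bound (here refl) = f[⊥]≤f[argmax] {f = f} x xs
  bound (there m)   = All.lookup (f[xs]≤f[argmax] {f = f} x xs) m

vacate-refill : ∀ {A p q u} → p ∈ A → p ≢ u → q ≢ u →
  SameCells (after (after A p q) u p) (q ∷ remove u A)
vacate-refill {A} {p} {q} {u} p∈A p≢u q≢u c = to , from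
  where
  to : c ∈ after (after A p q) u p → c ∈ q ∷ remove u A
  to m with ∈-after⁻ {after A p q} m
  ... | inj₂ refl = there (∈-remove⁺ A p∈A p≢u)
  ... | inj₁ (m′ , c≢u) with ∈-after⁻ {A} m′
  ...   | inj₁ (c∈A , _) = there (∈-remove⁺ A c∈A c≢u)
  ...   | inj₂ c≡q       = here c≡q
  from : c ∈ q ∷ remove u A → c ∈ after (after A p q) u p
  from (here refl) = ∈-after⁺ (inj₁ (∈-after⁺ {A} (inj₂ refl) , q≢u))
  from (there m) with ∈-remove⁻ A m | c ≟c p
  ... | _ | yes c≡p = ∈-after⁺ {after A p q} (inj₂ c≡p)
  ... | (c∈A , c≢u) | no c≢p = ∈-after⁺ (inj₁ (∈-after⁺ {A} {q = q} (inj₁ (c∈A , c≢p)) , c≢u))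

along-mk : ∀ o a b → along o (mk o a b) ≡ a
along-mk true  a b = refl
along-mk false a b = refl

across-mk : ∀ o a b → across o (mk o a b) ≡ b
across-mk true  a b = refl
across-mk false a b = refl

mk-η : ∀ o u → mk o (along o u) (across o u) ≡ u
mk-η true  (x , y) = refl
mk-η false (x , y) = refl

mk-step : ∀ o a b c e i → mk o a b ⊕ (i · mk o c e) ≡ mk o (offset a c i) (offset b e i)
mk-step true  a b c e i = refl
mk-step false a b c e i = refl

offset-still : ∀ a i → offset a (+ 0) i ≡ a
offset-still a i = trans (cong (a +ℤ_) (ℤP.*-zeroʳ (+ i))) (ℤP.+-identityʳ a)

along-unit : ∀ o → Unit (mk o (+ 1) (+ 0))
along-unit true  = right
along-unit false = up

across-unit : ∀ o {σ} → UnitSign σ → Unit (mk o (+ 0) (- σ))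
across-unit true  pos = down
across-unit true  neg = up
across-unit false pos = left
across-unit false neg = right

module Flatten (o : Bool) (r s : ℤ) where

  R : ℕ → Cell
  R j = mk o (s +ℤ + j) r

  eA : Cell
  eA = mk o (+ 1) (+ 0)

  R-injective : ∀ {i j} → R i ≡ R j → i ≡ j
  R-injective {i} {j} e = ℤP.+-injective (∙-cancelˡ s (+ i) (+ j)
    (trans (sym (along-mk o _ r)) (trans (cong (along o) e) (along-mk o _ r))))

  across-R : ∀ j → across o (R j) ≡ r
  across-R j = across-mk o _ r

  R-line : ∀ j → R j ≡ mk o s r ⊕ (j · eA)
  R-line j = sym (trans (mk-step o s r (+ 1) (+ 0) j) (cong₂ (mk o) (offset-pos s j) (offset-still r j)))

  R-step : ∀ j i → R j ⊕ (i · eA) ≡ R (j ℕ.+ i)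
  R-step j i = trans (mk-step o (s +ℤ + j) r (+ 1) (+ 0) i) (cong₂ (mk o) along-eq (offset-still r i))
    where
    along-eq : offset (s +ℤ + j) (+ 1) i ≡ s +ℤ + (j ℕ.+ i)
    along-eq = begin
      offset (s +ℤ + j) (+ 1) i ≡⟨ offset-pos (s +ℤ + j) i ⟩
      (s +ℤ + j) +ℤ + i        ≡⟨ ℤP.+-assoc s (+ j) (+ i) ⟩
      s +ℤ (+ j +ℤ + i)        ≡⟨ cong (s +ℤ_) (sym (ℤP.pos-+ j i)) ⟩
      s +ℤ + (j ℕ.+ i)         ∎
      where open ≡-Reasoning

  Comb : Shape → ℕ → Set
  Comb T ℓ = (∀ i → i < ℓ → R i ∈ T) ×
    (∀ u → u ∈ T → (s ≤ℤ along o u) × (along o u <ℤ s +ℤ + ℓ) ×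
       (∀ t → Between r t (across o u) → mk o (along o u) t ∈ T))

  height : Cell → ℕ
  height c = ℤ.∣ across o c ℤ.- r ∣

  height-zero : ∀ {c} → across o c ≡ r → height c ≡ 0
  height-zero on = cong ℤ.∣_∣ (trans (cong (ℤ._- r) on) (ℤP.+-inverseʳ r))

  height-zero⁻ : ∀ {c} → height c ≡ 0 → across o c ≡ r
  height-zero⁻ {c} h = ℤP.i-j≡0⇒i≡j (across o c) r (ℤP.∣i∣≡0⇒i≡0 h)

  off-row-≢R : ∀ {u} → across o u ≢ r → ∀ i → R i ≢ u
  off-row-≢R off i e = off (trans (cong (across o) (sym e)) (across-R i))

  column-foot : ∀ {T ℓ u} → Comb T ℓ → u ∈ T → ∃[ j ] (j < ℓ × along o u ≡ s +ℤ + j)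
  column-foot {ℓ = ℓ} (_ , column) u∈T =
    let (s≤ , <s+ℓ , _) = column _ u∈T ; (j , along≡) = ≤⇒∃+ s≤ in
    j , ℤP.drop‿+<+ (+-cancelˡ-< s (subst (_<ℤ s +ℤ + ℓ) along≡ <s+ℓ)) , along≡

  on-row : ∀ {T ℓ u} → Comb T ℓ → u ∈ T → across o u ≡ r → ∃[ j ] (j < ℓ × u ≡ R j)
  on-row {u = u} comb u∈T on = let (j , j<ℓ , along≡) = column-foot comb u∈T in
    j , j<ℓ , trans (sym (mk-η o u)) (cong₂ (mk o) along≡ on)

  R-outside : ∀ {T ℓ} → Comb T ℓ → R ℓ ∉ T
  R-outside {ℓ = ℓ} (_ , column) m =
    ℤP.<-irrefl (along-mk o (s +ℤ + ℓ) r) (proj₁ (proj₂ (column (R ℓ) m)))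

  off-row-length : ∀ {T ℓ c} → Comb T ℓ → c ∈ T → across o c ≢ r → ℓ < length T
  off-row-length {T} {ℓ} {c} (row , _) c∈T off =
    subst (_≤ length T) (cong suc (length-applyUpTo R ℓ))
      (length-mono-⊆ (c∉row ∷ applyUpTo-unique R R-injective ℓ) sub)
    where
    c∉row : All (c ≢_) (applyUpTo R ℓ)
    c∉row = All.tabulate λ m c≡ → let (j , _ , eq) = ∈-applyUpTo⁻ R m in
      off-row-≢R off j (sym (trans c≡ eq))
    sub : c ∷ applyUpTo R ℓ ⊆ T
    sub (here refl) = c∈T
    sub (there m)   = let (j , j<ℓ , eq) = ∈-applyUpTo⁻ R m in subst (_∈ T) (sym eq) (row j j<ℓ)

  on-row-length : ∀ {T ℓ} → Unique T → Comb T ℓ → (∀ {c} → c ∈ T → across o c ≡ r) → length T ≤ ℓ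
  on-row-length {T} {ℓ} un comb all-on =
    subst (length T ≤_) (length-applyUpTo R ℓ) (length-mono-⊆ un sub)
    where
    sub : T ⊆ applyUpTo R ℓ
    sub m = let (j , j<ℓ , eq) = on-row comb m (all-on m) in
      subst (_∈ applyUpTo R ℓ) (sym eq) (∈-applyUpTo⁺ R j<ℓ)

  comb-is-row : ∀ {T ℓ} → length T ≡ ℓ → Comb T ℓ → LineShape T (mk o s r) eA ℓ
  comb-is-row {T} {ℓ} len comb = lineShape λ c → on-line , from
    where
    on-line : ∀ {c} → c ∈ T → OnLine (mk o s r) eA ℓ c
    on-line {c} m with across o c ℤ.≟ r
    ... | yes on = let (j , j<ℓ , eq) = on-row comb m on in j , j<ℓ , trans eq (R-line j)
    ... | no off = ⊥-elim (ℕP.<-irrefl (sym len) (off-row-length comb m off))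
    from : ∀ {c} → OnLine (mk o s r) eA ℓ c → c ∈ T
    from (j , j<ℓ , refl) = subst (_∈ T) (R-line j) (proj₁ comb j j<ℓ)

  tallest-off-row : ∀ {T ℓ} → Unique T → ℓ < length T → Comb T ℓ →
    ∃[ u ] (u ∈ T × (∀ {v} → v ∈ T → height v ≤ height u) × across o u ≢ r)
  tallest-off-row {x ∷ xs} un ℓ<len comb with maximiser height x xs
  ... | u , u∈T , tallest = u , u∈T , tallest , off
    where
    off : across o u ≢ r
    off on = ℕP.<⇒≱ ℓ<len (on-row-length un comb λ m →
      height-zero⁻ (ℕP.n≤0⇒n≡0 (subst (_ ≤_) (height-zero on) (tallest m))))

  tallest-tops-column : ∀ {T u c t} → (∀ {v} → v ∈ T → height v ≤ height u) → c ∈ T →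
    Between r t (across o c) → mk o (along o c) t ≡ u → c ≡ u
  tallest-tops-column {u = u} {c} {t} tallest c∈T t-between at-u = begin
    c                                  ≡⟨ sym (mk-η o c) ⟩
    mk o (along o c) (across o c)      ≡⟨ cong₂ (mk o) same-along same-across ⟩
    mk o (along o u) (across o u)      ≡⟨ mk-η o u ⟩
    u                                  ∎
    where
    open ≡-Reasoning
    same-along : along o c ≡ along o u
    same-along = trans (sym (along-mk o _ t)) (cong (along o) at-u)
    t≡ : t ≡ across o u
    t≡ = trans (sym (across-mk o (along o c) t)) (cong (across o) at-u)
    same-across : across o c ≡ across o u
    same-across = between-far r (subst (λ z → Between r z (across o c)) t≡ t-between) (tallest c∈T)

  comb-step : ∀ {T ℓ u} → Comb T ℓ → u ∈ T → (∀ {v} → v ∈ T → height v ≤ height u) →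
    across o u ≢ r → Comb (R ℓ ∷ remove u T) (suc ℓ)
  comb-step {T} {ℓ} {u} (row , column) u∈T tallest off = row′ , column′
    where
    s+ℓ<s+1+ℓ : s +ℤ + ℓ <ℤ s +ℤ + suc ℓ
    s+ℓ<s+1+ℓ = ℤP.+-monoʳ-< s (ℤ.+<+ ℕP.≤-refl)
    row′ : ∀ i → i < suc ℓ → R i ∈ R ℓ ∷ remove u T
    row′ i i≤ℓ with i ℕ.≟ ℓ
    ... | yes refl = here refl
    ... | no  i≢ℓ  = there (∈-remove⁺ T (row i (ℕP.≤∧≢⇒< (ℕP.≤-pred i≤ℓ) i≢ℓ)) (off-row-≢R off i))
    column′ : ∀ c → c ∈ R ℓ ∷ remove u T →
      (s ≤ℤ along o c) × (along o c <ℤ s +ℤ + suc ℓ) ×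
      (∀ t → Between r t (across o c) → mk o (along o c) t ∈ R ℓ ∷ remove u T)
    column′ c (here refl) =
      subst (s ≤ℤ_) (sym (along-mk o _ r)) (ℤP.i≤i+j s (+ ℓ)) ,
      subst (_<ℤ s +ℤ + suc ℓ) (sym (along-mk o _ r)) s+ℓ<s+1+ℓ ,
      λ t t-between → here (cong₂ (mk o) (along-mk o _ r)
                                         (between-self (subst (Between r t) (across-R ℓ) t-between)))
    column′ c (there m) with ∈-remove⁻ T m
    ... | c∈T , c≢u with column c c∈T
    ... | s≤ , <s+ℓ , col = s≤ , ℤP.<-trans <s+ℓ s+ℓ<s+1+ℓ ,
      λ t t-between → there (∈-remove⁺ T (col t t-between)
                              (λ at-u → c≢u (tallest-tops-column tallest c∈T t-between at-u)))

  shift-row : ∀ {T ℓ j} → Comb T ℓ → j < ℓ → LineMove T (after T (R j) (R ℓ))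
  shift-row {T} {ℓ} {j} comb j<ℓ =
    lineMove (along-unit o) (ℕP.m<n⇒0<n∸m j<ℓ) cells end (R-outside comb)
    where
    j+[ℓ-j] : j ℕ.+ (ℓ ∸ j) ≡ ℓ
    j+[ℓ-j] = ℕP.m+[n∸m]≡n (ℕP.<⇒≤ j<ℓ)
    cells : ∀ i → i < ℓ ∸ j → R j ⊕ (i · eA) ∈ T
    cells i i<ℓ-j = subst (_∈ T) (sym (R-step j i))
      (proj₁ comb (j ℕ.+ i) (subst (j ℕ.+ i <_) j+[ℓ-j] (ℕP.+-monoʳ-< j i<ℓ-j)))
    end : R j ⊕ ((ℓ ∸ j) · eA) ≡ R ℓ
    end = trans (R-step j (ℓ ∸ j)) (cong R j+[ℓ-j])

  column-cell : ∀ {σ K} u → across o u ≡ offset r σ K → ∀ i → i ≤ K →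
    u ⊕ (i · mk o (+ 0) (- σ)) ≡ mk o (along o u) (offset r σ (K ∸ i))
  column-cell {σ} {K} u across≡ i i≤K = begin
    u ⊕ (i · eD)                                                    ≡⟨ cong (_⊕ (i · eD)) (sym (mk-η o u)) ⟩
    mk o (along o u) (across o u) ⊕ (i · eD)                        ≡⟨ mk-step o _ _ (+ 0) (- σ) i ⟩
    mk o (offset (along o u) (+ 0) i) (offset (across o u) (- σ) i) ≡⟨ cong₂ (mk o) (offset-still _ i) lowered ⟩
    mk o (along o u) (offset r σ (K ∸ i))                           ∎
    where
    open ≡-Reasoning
    eD : Cell
    eD = mk o (+ 0) (- σ)
    lowered : offset (across o u) (- σ) i ≡ offset r σ (K ∸ i)
    lowered = trans (cong (λ y → offset y (- σ) i) across≡) (offset-back r σ K i i≤K)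

  lower-column : ∀ {T ℓ j u} → Comb T ℓ → u ∈ T → j < ℓ → along o u ≡ s +ℤ + j → across o u ≢ r →
    LineMove (after T (R j) (R ℓ)) (after (after T (R j) (R ℓ)) u (R j))
  lower-column {T} {ℓ} {j} {u} (_ , column) u∈T j<ℓ foot off with signed-offset r (across o u)
  ... | σ , K , sign , across≡ = lineMove (across-unit o sign) K≥1 cells end free
    where
    eD : Cell
    eD = mk o (+ 0) (- σ)
    K≥1 : 1 ≤ K
    K≥1 = ℕP.n≢0⇒n>0 λ K≡0 → off (trans across≡ (trans (cong (offset r σ) K≡0) (offset-zero r σ)))
    cells : ∀ i → i < K → u ⊕ (i · eD) ∈ after T (R j) (R ℓ)
    cells i i<K rewrite column-cell u across≡ i (ℕP.<⇒≤ i<K) = ∈-after⁺ {T} (inj₁ (in-T , ≢Rj))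
      where
      in-T : mk o (along o u) (offset r σ (K ∸ i)) ∈ T
      in-T = proj₂ (proj₂ (column u u∈T)) _
        (subst (Between r _) (sym across≡) (between-offset⁺ r sign (ℕP.m∸n≤m K i)))
      ≢Rj : mk o (along o u) (offset r σ (K ∸ i)) ≢ R j
      ≢Rj e = ℕP.<⇒≢ (ℕP.m<n⇒0<n∸m i<K) (sym (offset-sign-injective r sign
        (trans (trans (sym (across-mk o _ _)) (trans (cong (across o) e) (across-R j)))
               (sym (offset-zero r σ)))))
    end : u ⊕ (K · eD) ≡ R j
    end = trans (column-cell u across≡ K ℕP.≤-refl)
      (cong₂ (mk o) foot (trans (cong (offset r σ) (ℕP.n∸n≡0 K)) (offset-zero r σ)))
    free : R j ∉ after T (R j) (R ℓ)
    free m with ∈-after⁻ {T} m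
    ... | inj₁ (_ , Rj≢Rj) = Rj≢Rj refl
    ... | inj₂ Rj≡Rℓ       = ℕP.<⇒≢ j<ℓ (R-injective Rj≡Rℓ)

  flatten-step : ∀ {T ℓ u} → Comb T ℓ → u ∈ T → across o u ≢ r → Moves 2 T (R ℓ ∷ remove u T)
  flatten-step {T} {ℓ} comb u∈T off with column-foot comb u∈T
  ... | j , j<ℓ , foot =
    move (shift-row comb j<ℓ) (move (lower-column comb u∈T j<ℓ foot off)
      (done (vacate-refill (proj₁ comb j j<ℓ) (off-row-≢R off j) (off-row-≢R off ℓ))))

  flatten : ∀ N {T ℓ} → Unique T → length T ≡ ℓ ℕ.+ N → Comb T ℓ →
    Σ Shape λ C → LineShape C (mk o s r) eA (ℓ ℕ.+ N) × Moves (2 * N) T C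
  flatten zero {T} {ℓ} _ len comb =
    T , subst (LineShape T (mk o s r) eA) (sym (ℕP.+-identityʳ ℓ))
              (comb-is-row (trans len (ℕP.+-identityʳ ℓ)) comb) ,
    done SameCells-refl
  flatten (suc N) {T} {ℓ} un len comb
    with tallest-off-row un (subst (ℓ <_) (sym len) (ℕP.m<m+n ℓ ℕP.0<1+n)) comb
  ... | u , u∈T , tallest , off
    with flatten N un′ len′ (comb-step comb u∈T tallest off)
    where
    un′ : Unique (R ℓ ∷ remove u T)
    un′ = All.tabulate (λ m Rℓ≡ → R-outside comb (subst (_∈ T) (sym Rℓ≡) (proj₁ (∈-remove⁻ T m))))
          ∷ remove-unique un
    len′ : length (R ℓ ∷ remove u T) ≡ suc ℓ ℕ.+ N
    len′ = trans (length-remove un u∈T) (trans len (ℕP.+-suc ℓ N))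
  ... | C , line , moves =
    C , subst (LineShape C (mk o s r) eA) (sym (ℕP.+-suc ℓ N)) line ,
    subst (λ m → Moves m T C) (sym (ℕP.*-suc 2 N)) (flatten-step comb u∈T off ++ᴹ moves)

nice-to-line : ∀ {n S} → Unique S → length S ≡ n → Nice S →
  ∃[ o ] ∃[ p ] Σ Shape λ C → LineShape C p (mk o (+ 1) (+ 0)) n ×
    ∃[ m ] (m ≤ 2 * n × Moves m S C)
nice-to-line {n} {S} un len (_ , o , r , s , k , _ , row , column) =
  o , mk o s r , C , subst (LineShape C (mk o s r) eA) k+[n-k] line ,
  2 * (n ∸ k) , ℕP.*-monoʳ-≤ 2 (ℕP.m∸n≤m n k) , moves
  where
  open Flatten o r s
  k≤n : k ≤ n
  k≤n = subst₂ _≤_ (length-applyUpTo R k) len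
    (length-mono-⊆ (applyUpTo-unique R R-injective k)
      λ m → let (j , j<k , eq) = ∈-applyUpTo⁻ R m in subst (_∈ S) (sym eq) (row j j<k))
  k+[n-k] : k ℕ.+ (n ∸ k) ≡ n
  k+[n-k] = ℕP.m+[n∸m]≡n k≤n
  flattened : Σ Shape λ C → LineShape C (mk o s r) eA (k ℕ.+ (n ∸ k)) × Moves (2 * (n ∸ k)) S C
  flattened = flatten (n ∸ k) un (trans len (sym k+[n-k])) (row , column)
  C : Shape
  C = proj₁ flattened
  line : LineShape C (mk o s r) eA (k ℕ.+ (n ∸ k))
  line = proj₁ (proj₂ flattened)
  moves : Moves (2 * (n ∸ k)) S C
  moves = proj₂ (proj₂ flattened)

axis-rotation : ∀ {d d′} → Axis d → Axis d′ → ∃[ q ] (q < 4 × rotN q d ≡ d′)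
axis-rotation horiz horiz = 0 , s≤s z≤n , refl
axis-rotation horiz vert  = 1 , s≤s (s≤s z≤n) , refl
axis-rotation vert  horiz = 3 , s≤s (s≤s (s≤s (s≤s z≤n))) , refl
axis-rotation vert  vert  = 0 , s≤s z≤n , refl

axis-unit : ∀ {d} → Axis d → Unit d
axis-unit horiz = right
axis-unit vert  = up

row-axis : ∀ o → Axis (mk o (+ 1) (+ 0))
row-axis true  = horiz
row-axis false = vert

-- If A can be moved onto a line, then A and any line of the same order
-- transform into each other: move and align by an isometry, or reverse the
-- moves and apply the isometry to A instead.
onto-line⇒transforms : ∀ {m A C B p d p′ d′ n} → Axis d → Axis d′ →
  Moves m A C → LineShape C p d n → LineShape B p′ d′ n →
  Transforms m A B × Transforms m B A
onto-line⇒transforms {A = A} {C} {B} {p} {d} {p′} axis axis′ moves lineC lineB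
  with axis-rotation axis′ axis | axis-rotation axis axis′
... | q , q<4 , d′↦d | q′ , q′<4 , d↦d′ =
  (C , congruent-image q t q<4 (sameLineShape lineC (align q d′↦d lineB)) , moves) ,
  (map (iso q′ t′) A , congruent-image q′ t′ q′<4 SameCells-refl ,
   moves-resp (sameLineShape lineB (align q′ d↦d′ lineC))
              (iso-moves q′ t′ (reverseMoves moves)))
  where
  t t′ : Cell
  t  = p ⊖c rotN q p′
  t′ = p′ ⊖c rotN q′ p

line-of-order : ∀ {n S} → Unique S → length S ≡ n → IsLine S →
  ∃[ p ] ∃[ d ] (Axis d × LineShape S p d n)
line-of-order unS lenS (p , d , K , axis , _ , cells) =
  p , d , axis , subst (LineShape _ p d) (trans (sym (lineShape-length (axis-unit axis) unS line)) lenS) line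
  where
  line : LineShape _ p d K
  line = lineShape cells

proposition2p12 : ∃[ c ] ∀ (n : ℕ) (SNice SL : Shape) →
    Unique SNice → Unique SL → length SNice ≡ n → length SL ≡ n →
    Nice SNice → IsLine SL →
    (∃[ m ] (m ≤ c * n × Transforms m SNice SL)) ×
    (∃[ m ] (m ≤ c * n × Transforms m SL SNice))
proposition2p12 = 2 , λ n SNice SL unN unL lenN lenL nice line →
  let (o , _ , C , lineC , m , m≤2n , moves) = nice-to-line unN lenN nice
      (_ , _ , axis , lineSL) = line-of-order unL lenL line
      (forward , backward) = onto-line⇒transforms (row-axis o) axis moves lineC lineSL
  in (m , m≤2n , forward) , (m , m≤2n , backward)
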